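{- In Picaria, consider the placement-phase position with a single X-stone on $(2,3)$, a single O-stone on the center $(2,2)$, all other nodes empty, and X to place next. Then X cannot win from this position.
   Context: Picaria is played on the nine nodes of a $3\times 3$ grid; write $(r,c)$ for the node in row $r$ (rows $1,2,3$ from top to bottom) and column $c$ (columns $1,2,3$ from left to right). Two nodes are adjacent if they are distinct neighbours horizontally, vertically or diagonally. A line is one of the eight triples of nodes forming a row, a column or a main diagonal. Players X and O each own three stones and alternate turns, X first. Placement phase: the mover places one of its stones on an empty node, until all six stones are on the board. Sliding phase (X first): the mover slides one of its own stones to an adjacent empty node. A player wins as soon as its three stones occupy a line; play may continue forever, in which case nobody wins. A player "cannot win" from a position if the opponent has a strategy from that position guaranteeing that the player never obtains three of its stones on a line. -}

module Defs where

open import Data.Nat using (ℕ; suc; _≤_; _<_)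
open import Data.Fin using (Fin; zero; suc; toℕ) renaming (_≟_ to _≟F_)
open import Data.Product using (Σ; _×_; _,_; proj₁; proj₂)
open import Data.Product.Properties using (≡-dec)
open import Data.Sum using (_⊎_; inj₁; inj₂)
open import Data.List using (List; []; _∷_; length; filter; cartesianProduct; allFin)
open import Data.List.Relation.Unary.Any using (Any)
open import Relation.Binary.PropositionalEquality using (_≡_; _≢_; refl)
open import Relation.Nullary using (¬_; Dec; yes; no)
open import Data.Bool using (if_then_else_)
open import Relation.Nullary.Decidable using (does)

data Player : Set where
  X O : Player

other : Player → Player
other X = O
other O = X

data Cell : Set where
  empty : Cell
  stone : Player → Cell

_≟C_ : (a b : Cell) → Dec (a ≡ b)
empty ≟C empty = yes refl
empty ≟C stone _ = no λ ()
stone _ ≟C empty = no λ ()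
stone X ≟C stone X = yes refl
stone X ≟C stone O = no λ ()
stone O ≟C stone X = no λ ()
stone O ≟C stone O = yes refl

-- Node (r , c): row r (top to bottom), column c (left to right); Fin 3 index 0,1,2 = 1,2,3
Node : Set
Node = Fin 3 × Fin 3

_≟N_ : (n m : Node) → Dec (n ≡ m)
_≟N_ = ≡-dec _≟F_ _≟F_

i1 i2 i3 : Fin 3
i1 = zero
i2 = suc zero
i3 = suc (suc zero)

allNodes : List Node
allNodes = cartesianProduct (allFin 3) (allFin 3)

Near : Fin 3 → Fin 3 → Set
Near i j = toℕ i ≤ suc (toℕ j) × toℕ j ≤ suc (toℕ i)

Adjacent : Node → Node → Set
Adjacent n m = n ≢ m × Near (proj₁ n) (proj₁ m) × Near (proj₂ n) (proj₂ m)

Line : Set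
Line = Node × Node × Node

lines : List Line
lines =
  ((i1 , i1) , (i1 , i2) , (i1 , i3)) ∷
  ((i2 , i1) , (i2 , i2) , (i2 , i3)) ∷
  ((i3 , i1) , (i3 , i2) , (i3 , i3)) ∷
  ((i1 , i1) , (i2 , i1) , (i3 , i1)) ∷
  ((i1 , i2) , (i2 , i2) , (i3 , i2)) ∷
  ((i1 , i3) , (i2 , i3) , (i3 , i3)) ∷
  ((i1 , i1) , (i2 , i2) , (i3 , i3)) ∷
  ((i1 , i3) , (i2 , i2) , (i3 , i1)) ∷ []

Board : Set
Board = Node → Cell

HasLine : Player → Board → Set
HasLine p b = Any (λ l → b (proj₁ l) ≡ stone p × b (proj₁ (proj₂ l)) ≡ stone p × b (proj₂ (proj₂ l)) ≡ stone p) lines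

count : Player → Board → ℕ
count p b = length (filter (λ n → b n ≟C stone p) allNodes)

update : Board → Node → Cell → Board
update b n c m = if does (n ≟N m) then c else b m

record Pos : Set where
  constructor pos
  field
    board  : Board
    toMove : Player
open Pos public

Won : Pos → Set
Won s = HasLine X (board s) ⊎ HasLine O (board s)

data Step : Pos → Pos → Set where
  place : ∀ {b p} (n : Node) → count p b < 3 → b n ≡ empty →
          Step (pos b p) (pos (update b n (stone p)) (other p))
  slide : ∀ {b p} (n m : Node) → count X b ≡ 3 → count O b ≡ 3 →
          b n ≡ stone p → b m ≡ empty → Adjacent n m →
          Step (pos b p) (pos (update (update b n empty) m (stone p)) (other p))

Strategy : Player → Set
Strategy q = (h : List Pos) (s : Pos) → toMove s ≡ q → ¬ Won s →
             Σ Pos (Step s) ⊎ (∀ t → ¬ Step s t)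

-- positions reachable from s₀ (with the history of earlier positions, most
-- recent first) when q plays according to σ and the opponent plays arbitrarily;
-- play stops as soon as someone has won or the mover has no legal move
data Reach (q : Player) (σ : Strategy q) (s₀ : Pos) : List Pos → Pos → Set where
  start : Reach q σ s₀ [] s₀
  other-move : ∀ {h s t} → Reach q σ s₀ h s → toMove s ≡ other q → ¬ Won s →
               Step s t → Reach q σ s₀ (s ∷ h) t
  own-move : ∀ {h s t st} → Reach q σ s₀ h s → (e : toMove s ≡ q) (nw : ¬ Won s) →
             σ h s e nw ≡ inj₁ (t , st) → Reach q σ s₀ (s ∷ h) t

CannotWin : Player → Pos → Set
CannotWin p s₀ = Σ (Strategy (other p)) λ σ →
  ∀ h s → Reach (other p) σ s₀ h s → ¬ HasLine p (board s)

initBoard : Board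
initBoard (r , c) with does ((r , c) ≟N (i2 , i3)) | does ((r , c) ≟N (i2 , i2))
... | Data.Bool.true | _ = stone X
... | Data.Bool.false | Data.Bool.true = stone O
... | Data.Bool.false | Data.Bool.false = empty

startPos : Pos
startPos = pos initBoard X

module Submission where

open import Defs
open import Data.Nat using (_<_; _≤?_; _<?_) renaming (_≟_ to _≟ℕ_)
open import Data.Product using (Σ; _×_; _,_; proj₁; proj₂; uncurry)
open import Data.Sum using (_⊎_; inj₁; inj₂)
open import Data.List using (List; []; _∷_; length; map; _++_; cartesianProduct)
open import Data.List.Properties using (filter-≐)
open import Data.List.Relation.Unary.All as All using (All; all?)
open import Data.List.Relation.Unary.Any as Any using (Any; any?; satisfied)
open import Data.List.Membership.Propositional using (_∈_; lose)
open import Data.List.Membership.Propositional.Properties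
  using (∈-++⁺ˡ; ∈-++⁺ʳ; ∈-map⁺; ∈-cartesianProduct⁺; ∈-allFin)
open import Data.Vec using (Vec; _∷_; []; lookup; tabulate)
open import Data.Vec.Properties using (lookup∘tabulate; tabulate-cong) renaming (≡-dec to ≡-dec-Vec)
open import Data.Bool using (if_then_else_)
open import Data.Empty using (⊥-elim)
open import Data.Unit using (tt)
open import Function using (_∘_)
open import Relation.Nullary using (¬_; Dec; yes; no; does)
open import Relation.Nullary.Decidable using (_×-dec_; _⊎-dec_; _→-dec_; ¬?; toWitness)
open import Relation.Binary.Definitions using (DecidableEquality)
open import Relation.Binary.PropositionalEquality using (_≡_; _≗_; refl; sym; trans; cong; subst)

-- O defends with a certificate found by retrograde analysis: a list of 86 positions
-- with X to move, containing the start and free of lines, such that after every legal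
-- X move X still has no line and O has a reply that either completes an O line or
-- leads back into the list.  Answering this way keeps play inside the list until O
-- wins, so X never completes a line.  The certificate is checked by evaluation.

Grid : Set
Grid = Vec (Vec Cell 3) 3

cellAt : Grid → Board
cellAt g (r , c) = lookup (lookup g r) c

snapshot : Board → Grid
snapshot b = tabulate λ r → tabulate λ c → b (r , c)

cellAt-snapshot : ∀ b → cellAt (snapshot b) ≗ b
cellAt-snapshot b (r , c) =
  trans (cong (λ row → lookup row c) (lookup∘tabulate (λ r → tabulate λ c → b (r , c)) r))
        (lookup∘tabulate (λ c → b (r , c)) c)

snapshot-cong : ∀ {b b'} → b ≗ b' → snapshot b ≡ snapshot b'
snapshot-cong b≗b' = tabulate-cong λ r → tabulate-cong λ c → b≗b' (r , c)

_≟G_ : DecidableEquality Grid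
_≟G_ = ≡-dec-Vec (≡-dec-Vec _≟C_)

open import Data.List.Membership.DecPropositional _≟G_ using (_∈?_)

data Move : Set where
  put   : Node → Move
  shift : Node → Node → Move

-- The conditions of a slide are listed cheapest first, for the sake of  legal? .
Legal : Board → Player → Move → Set
Legal b p (put n)     = count p b < 3 × b n ≡ empty
Legal b p (shift n m) = b n ≡ stone p × b m ≡ empty × Adjacent n m × count X b ≡ 3 × count O b ≡ 3

play : Board → Player → Move → Board
play b p (put n)     = update b n (stone p)
play b p (shift n m) = update (update b n empty) m (stone p)

legal⇒step : ∀ {b p} mv → Legal b p mv → Step (pos b p) (pos (play b p mv) (other p))
legal⇒step (put n)     (c<3 , n-empty)                   = place n c<3 n-empty
legal⇒step (shift n m) (n-own , m-empty , adj , cX , cO) = slide n m cX cO n-own m-empty adj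

step⇒legal : ∀ {b p t} → Step (pos b p) t → Σ Move λ mv → Legal b p mv × t ≡ pos (play b p mv) (other p)
step⇒legal (place n c<3 n-empty)               = put n , (c<3 , n-empty) , refl
step⇒legal (slide n m cX cO n-own m-empty adj) = shift n m , (n-own , m-empty , adj , cX , cO) , refl

adjacent? : ∀ n m → Dec (Adjacent n m)
adjacent? n m = ¬? (n ≟N m) ×-dec (near? _ _ ×-dec near? _ _)
  where
  near? : ∀ i j → Dec (Near i j)
  near? i j = (_ ≤? _) ×-dec (_ ≤? _)

legal? : ∀ b p mv → Dec (Legal b p mv)
legal? b p (put n)     = (count p b <? 3) ×-dec (b n ≟C empty)
legal? b p (shift n m) =
  (b n ≟C stone p) ×-dec (b m ≟C empty) ×-dec adjacent? n m ×-dec (count X b ≟ℕ 3) ×-dec (count O b ≟ℕ 3)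

∈-allNodes : ∀ n → n ∈ allNodes
∈-allNodes (r , c) = ∈-cartesianProduct⁺ (∈-allFin r) (∈-allFin c)

allMoves : List Move
allMoves = map put allNodes ++ map (uncurry shift) (cartesianProduct allNodes allNodes)

∈-allMoves : ∀ mv → mv ∈ allMoves
∈-allMoves (put n)     = ∈-++⁺ˡ (∈-map⁺ put (∈-allNodes n))
∈-allMoves (shift n m) =
  ∈-++⁺ʳ (map put allNodes) (∈-map⁺ (uncurry shift) (∈-cartesianProduct⁺ (∈-allNodes n) (∈-allNodes m)))

move-or-stuck : ∀ b p → Σ Pos (Step (pos b p)) ⊎ (∀ t → ¬ Step (pos b p) t)
move-or-stuck b p with any? (legal? b p) allMoves
... | yes legal = inj₁ (_ , legal⇒step _ (proj₂ (satisfied legal)))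
... | no stuck  = inj₂ λ t st → let (mv , legal , _) = step⇒legal st in stuck (lose (∈-allMoves mv) legal)

hasLine? : ∀ p b → Dec (HasLine p b)
hasLine? p b = any? (λ (u , v , w) → (b u ≟C stone p) ×-dec (b v ≟C stone p) ×-dec (b w ≟C stone p)) lines

hasLine-resp-≗ : ∀ p {b b'} → b ≗ b' → HasLine p b → HasLine p b'
hasLine-resp-≗ p b≗b' = Any.map λ (eu , ev , ew) → trans (sym (b≗b' _)) eu , trans (sym (b≗b' _)) ev , trans (sym (b≗b' _)) ew

count-cong : ∀ p {b b'} → b ≗ b' → count p b ≡ count p b'
count-cong p {b} {b'} b≗b' =
  cong length (filter-≐ (λ n → b n ≟C stone p) (λ n → b' n ≟C stone p)
                        ((λ {n} → trans (sym (b≗b' n))) , (λ {n} → trans (b≗b' n))) allNodes)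

legal-resp-≗ : ∀ p mv {b b'} → b ≗ b' → Legal b p mv → Legal b' p mv
legal-resp-≗ p (put n) b≗b' (c<3 , n-empty) =
  subst (_< 3) (count-cong p b≗b') c<3 , trans (sym (b≗b' n)) n-empty
legal-resp-≗ p (shift n m) b≗b' (n-own , m-empty , adj , cX , cO) =
  trans (sym (b≗b' n)) n-own , trans (sym (b≗b' m)) m-empty , adj ,
  trans (sym (count-cong X b≗b')) cX , trans (sym (count-cong O b≗b')) cO

update-cong : ∀ {b b'} → b ≗ b' → ∀ n c → update b n c ≗ update b' n c
update-cong b≗b' n c m = cong (if does (n ≟N m) then c else_) (b≗b' m)

play-cong : ∀ p mv {b b'} → b ≗ b' → play b p mv ≗ play b' p mv
play-cong p (put n)     b≗b' = update-cong b≗b' n (stone p)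
play-cong p (shift n m) b≗b' = update-cong (update-cong b≗b' n empty) m (stone p)

module Defence (safe : List Grid) where

  WonByO : Board → Set
  WonByO b = HasLine O b × ¬ HasLine X b

  Secure : Board → Set
  Secure b = WonByO b ⊎ snapshot b ∈ safe

  GoodReply : Board → Move → Set
  GoodReply b mv = Legal b O mv × Secure (play b O mv)

  Answerable : Board → Set
  Answerable b = ¬ HasLine X b × Any (GoodReply b) allMoves

  Defended : Board → Set
  Defended b = ¬ HasLine X b × (HasLine O b ⊎ All (λ mv → Legal b X mv → Answerable (play b X mv)) allMoves)

  goodReply? : ∀ b mv → Dec (GoodReply b mv)
  goodReply? b mv = legal? b O mv ×-dec ((hasLine? O b' ×-dec ¬? (hasLine? X b')) ⊎-dec (snapshot b' ∈? safe))
    where b' = play b O mv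

  answerable? : ∀ b → Dec (Answerable b)
  answerable? b = ¬? (hasLine? X b) ×-dec any? (goodReply? b) allMoves

  defended? : ∀ b → Dec (Defended b)
  defended? b =
    ¬? (hasLine? X b) ×-dec (hasLine? O b ⊎-dec all? (λ mv → legal? b X mv →-dec answerable? (play b X mv)) allMoves)

  secure-resp-≗ : ∀ {b b'} → b ≗ b' → Secure b → Secure b'
  secure-resp-≗ b≗b' (inj₁ (o , ¬x)) = inj₁ (hasLine-resp-≗ O b≗b' o , ¬x ∘ hasLine-resp-≗ X (sym ∘ b≗b'))
  secure-resp-≗ b≗b' (inj₂ b∈safe)   = inj₂ (subst (_∈ safe) (snapshot-cong b≗b') b∈safe)

  answerable-resp-≗ : ∀ {b b'} → b ≗ b' → Answerable b → Answerable b'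
  answerable-resp-≗ {b} {b'} b≗b' (¬x , replies) = ¬x ∘ hasLine-resp-≗ X (sym ∘ b≗b') , Any.map transport replies
    where
    transport : ∀ {mv} → GoodReply b mv → GoodReply b' mv
    transport {mv} (legal , secure) = legal-resp-≗ O mv b≗b' legal , secure-resp-≗ (play-cong O mv b≗b') secure

  defended-resp-≗ : ∀ {b b'} → b ≗ b' → Defended b → Defended b'
  defended-resp-≗ b≗b' (¬x , inj₁ o)       = ¬x ∘ hasLine-resp-≗ X (sym ∘ b≗b') , inj₁ (hasLine-resp-≗ O b≗b' o)
  defended-resp-≗ {b} {b'} b≗b' (¬x , inj₂ answers) =
    ¬x ∘ hasLine-resp-≗ X (sym ∘ b≗b') , inj₂ (All.map transport answers)
    where
    transport : ∀ {mv} → (Legal b X mv → Answerable (play b X mv)) → Legal b' X mv → Answerable (play b' X mv)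
    transport {mv} answer legal =
      answerable-resp-≗ (play-cong X mv b≗b') (answer (legal-resp-≗ X mv (sym ∘ b≗b') legal))

  respondWith : ∀ b → Dec (Any (GoodReply b) allMoves) → Σ Pos (Step (pos b O)) ⊎ (∀ t → ¬ Step (pos b O) t)
  respondWith b (yes reply) = inj₁ (_ , legal⇒step _ (proj₁ (proj₂ (satisfied reply))))
  -- Never taken in an answerable position; it only makes the strategy total.
  respondWith b (no _)      = move-or-stuck b O

  strategy : Strategy O
  strategy _ (pos b .O) refl _ = respondWith b (any? (goodReply? b) allMoves)

  Invariant : Pos → Set
  Invariant (pos b X) = Defended b
  Invariant (pos b O) = Answerable b

  module _ (certificate : All (Defended ∘ cellAt) safe) where

    secure⇒defended : ∀ {b} → Secure b → Defended b
    secure⇒defended     (inj₁ (o , ¬x)) = ¬x , inj₁ o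
    secure⇒defended {b} (inj₂ b∈safe) = defended-resp-≗ (cellAt-snapshot b) (All.lookup certificate b∈safe)

    respondWith-invariant : ∀ b d {t st} → Answerable b → respondWith b d ≡ inj₁ (t , st) → Invariant t
    respondWith-invariant b (yes reply) _         refl = secure⇒defended (proj₂ (proj₂ (satisfied reply)))
    respondWith-invariant b (no none)   (_ , reply) _  = ⊥-elim (none reply)

    reach-invariant : ∀ {b₀ h s} → Defended b₀ → Reach O strategy (pos b₀ X) h s → Invariant s
    reach-invariant d₀ start = d₀
    reach-invariant d₀ (other-move {s = pos b .X} r refl ¬won st) with step⇒legal st | reach-invariant d₀ r
    ... | _  , _     , refl | _ , inj₁ o       = ⊥-elim (¬won (inj₂ o))
    ... | mv , legal , refl | _ , inj₂ answers = All.lookup answers (∈-allMoves mv) legal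
    reach-invariant d₀ (own-move {s = pos b .O} r refl _ chosen) =
      respondWith-invariant b (any? (goodReply? b) allMoves) (reach-invariant d₀ r) chosen

    cannotWin : ∀ {b₀} → snapshot b₀ ∈ safe → CannotWin X (pos b₀ X)
    cannotWin {b₀} b₀∈safe = strategy , λ _ s r → noLine s (reach-invariant d₀ r)
      where
      d₀ : Defended b₀
      d₀ = secure⇒defended (inj₂ b₀∈safe)

      noLine : ∀ s → Invariant s → ¬ HasLine X (board s)
      noLine (pos b X) = proj₁
      noLine (pos b O) = proj₁

defendedGrids : List Grid
defendedGrids =
  grid ∙ ∙ ∙  ∙ o x  ∙ ∙ ∙ ∷
  grid ∙ ∙ o  ∙ o x  ∙ ∙ x ∷
  grid ∙ ∙ o  x o x  ∙ ∙ ∙ ∷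
  grid ∙ ∙ x  ∙ o x  ∙ ∙ o ∷
  grid ∙ o ∙  ∙ o x  x ∙ ∙ ∷
  grid ∙ x o  ∙ o x  ∙ ∙ ∙ ∷
  grid o ∙ ∙  ∙ o x  ∙ x ∙ ∷
  grid x ∙ ∙  ∙ o x  o ∙ ∙ ∷
  grid ∙ ∙ ∙  o o x  x x o ∷
  grid ∙ ∙ ∙  o x o  o x x ∷
  grid ∙ ∙ ∙  o x o  x o x ∷
  grid ∙ ∙ ∙  o x o  x x o ∷
  grid ∙ ∙ ∙  x o o  o x x ∷
  grid ∙ ∙ o  ∙ o x  x o x ∷
  grid ∙ ∙ o  o x x  x ∙ o ∷
  grid ∙ ∙ o  o x x  x o ∙ ∷
  grid ∙ ∙ o  x o x  x o ∙ ∷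
  grid ∙ ∙ x  ∙ o o  o x x ∷
  grid ∙ ∙ x  x o o  ∙ o x ∷
  grid ∙ ∙ x  x o o  o ∙ x ∷
  grid ∙ ∙ x  x o o  o x ∙ ∷
  grid ∙ o ∙  ∙ o x  x x o ∷
  grid ∙ o ∙  o x x  ∙ x o ∷
  grid ∙ o ∙  x x o  o x ∙ ∷
  grid ∙ o o  ∙ x x  ∙ o x ∷
  grid ∙ o x  ∙ o x  ∙ x o ∷
  grid ∙ o x  ∙ x ∙  o x o ∷
  grid ∙ o x  ∙ x o  ∙ o x ∷
  grid ∙ o x  ∙ x o  o x ∙ ∷
  grid ∙ o x  ∙ x x  ∙ o o ∷
  grid ∙ o x  x o ∙  ∙ x o ∷
  grid ∙ o x  x o ∙  o x ∙ ∷
  grid ∙ o x  x o o  ∙ ∙ x ∷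
  grid ∙ o x  x x o  o ∙ ∙ ∷
  grid ∙ x ∙  ∙ o o  x o x ∷
  grid ∙ x ∙  o o ∙  x o x ∷
  grid ∙ x o  ∙ o ∙  x o x ∷
  grid ∙ x o  ∙ o x  ∙ o x ∷
  grid ∙ x o  o o x  x ∙ ∙ ∷
  grid ∙ x o  o x ∙  x o ∙ ∷
  grid ∙ x o  o x x  ∙ o ∙ ∷
  grid ∙ x o  x o ∙  ∙ o x ∷
  grid ∙ x x  ∙ o o  ∙ o x ∷
  grid o ∙ ∙  x ∙ o  o x x ∷
  grid o ∙ ∙  x o ∙  x o x ∷
  grid o ∙ ∙  x x o  ∙ o x ∷
  grid o ∙ ∙  x x o  o ∙ x ∷
  grid o ∙ o  ∙ o x  ∙ x x ∷
  grid o ∙ x  x x o  o ∙ ∙ ∷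
  grid o o ∙  x x ∙  x o ∙ ∷
  grid o x ∙  ∙ o o  ∙ x x ∷
  grid o x ∙  ∙ o x  x o ∙ ∷
  grid o x ∙  ∙ x o  ∙ o x ∷
  grid o x ∙  x o ∙  ∙ o x ∷
  grid o x ∙  x o ∙  x o ∙ ∷
  grid o x ∙  x o o  ∙ ∙ x ∷
  grid o x ∙  x x o  ∙ o ∙ ∷
  grid o x o  ∙ x ∙  ∙ o x ∷
  grid o x o  ∙ x ∙  x o ∙ ∷
  grid o x o  x ∙ ∙  x o ∙ ∷
  grid o x x  o x o  ∙ ∙ ∙ ∷
  grid o x x  x o o  ∙ ∙ ∙ ∷
  grid x ∙ ∙  o o x  ∙ x o ∷
  grid x ∙ ∙  o o x  x ∙ o ∷
  grid x ∙ ∙  o o x  x o ∙ ∷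
  grid x ∙ o  o x x  ∙ ∙ o ∷
  grid x o ∙  ∙ o x  ∙ x o ∷
  grid x o ∙  ∙ o x  o x ∙ ∷
  grid x o ∙  ∙ x ∙  o x o ∷
  grid x o ∙  o o ∙  x x ∙ ∷
  grid x o ∙  o o x  x ∙ ∙ ∷
  grid x o ∙  o x ∙  ∙ x o ∷
  grid x o ∙  o x ∙  x o ∙ ∷
  grid x o ∙  o x x  ∙ ∙ o ∷
  grid x o ∙  x o ∙  o x ∙ ∷
  grid x o ∙  x x ∙  o o ∙ ∷
  grid x o x  ∙ o ∙  ∙ x o ∷
  grid x o x  ∙ o o  ∙ x ∙ ∷
  grid x o x  ∙ o x  ∙ ∙ o ∷
  grid x o x  ∙ o x  o ∙ ∙ ∷
  grid x o x  o o ∙  ∙ x ∙ ∷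
  grid x o x  o x o  ∙ ∙ ∙ ∷
  grid x o x  x o ∙  o ∙ ∙ ∷
  grid x x o  o o ∙  x ∙ ∙ ∷
  grid x x o  o o x  ∙ ∙ ∙ ∷
  grid x x o  o x o  ∙ ∙ ∙ ∷
  []
  where
  ∙ x o : Cell
  ∙ = empty
  x = stone X
  o = stone O

  grid : (a b c d e f g h i : Cell) → Grid
  grid a b c d e f g h i = (a ∷ b ∷ c ∷ []) ∷ (d ∷ e ∷ f ∷ []) ∷ (g ∷ h ∷ i ∷ []) ∷ []

open Defence defendedGrids

lemma2p7 : CannotWin X startPos
lemma2p7 = cannotWin (toWitness {a? = all? (defended? ∘ cellAt) defendedGrids} tt)
                     (toWitness {a? = snapshot initBoard ∈? defendedGrids} tt)
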